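{- Let $n \ge 1$, let $k$ be a positive integer, and let $s \in \mathcal{S}_n$. Run the following procedure (greedy provisional acceptance) on $s$. Initialize $i := 1$, $j := 2$, state $:=$ up, $A := \emptyset$. While $j \le n$: if state is up and $s(i) < s(j) < s(i)+k$, set $j := j+1$; else if state is up and $s(i) > s(j)$, set $i := j$, $j := j+1$; else if state is up (so $s(j) \ge s(i)+k$), set $A := A \cup \{i\}$, $i := j$, $j := j+1$, state $:=$ down; else (state is down) if $s(i) > s(j) > s(i)-k$, set $j:=j+1$; else if $s(i) < s(j)$, set $i := j$, $j:=j+1$; else (so $s(j) \le s(i)-k$) set $A := A \cup\{i\}$, $i:=j$, $j := j+1$, state $:=$ up. When the loop terminates, set $A := A \cup \{i\}$. Then, listing $A = \{a_1 < \cdots < a_m\}$, the subsequence $(s(a_1),\ldots,s(a_m))$ is a $k$-alternating subsequence of $s$ of maximal length among all $k$-alternating subsequences of $s$.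
   Context: A permutation $s \in \mathcal{S}_n$ is viewed as the word $(s(1),\ldots,s(n))$; a subsequence is $(s(a_1),\ldots,s(a_m))$ with $a_1<\cdots<a_m$. A sequence $(b_1,\ldots,b_m)$ is $k$-alternating if $(-1)^j(b_j - b_{j+1}) \ge k$ for all $j \in \{1,\ldots,m-1\}$ (up-step first, every jump at least $k$); sequences of length $\le 1$ are trivially $k$-alternating. -}

module Defs where

open import Data.Nat using (ℕ; zero; suc; _+_; _≤_; _<_; _<?_)
open import Data.Fin as Fin using (Fin; toℕ)
open import Data.Fin.Permutation using (Permutation′; _⟨$⟩ʳ_)
open import Data.List using (allFin; List; []; _∷_; _++_; [_]; map; foldl; length)
open import Data.List.Relation.Unary.Linked using (Linked)
open import Data.Product using (_×_; _,_)
open import Data.Unit using (⊤)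
open import Relation.Nullary using (yes; no)

-- The word of a permutation s ∈ S_n, with values in {1,…,n}:
-- position i (0-based Fin n, i.e. paper position i+1) holds s(i).
word : ∀ {n} → Permutation′ n → Fin n → ℕ
word π i = suc (toℕ (π ⟨$⟩ʳ i))

data Dir : Set where
  up down : Dir

AltFrom : ℕ → Dir → List ℕ → Set
AltFrom k d [] = ⊤
AltFrom k d (b ∷ []) = ⊤
AltFrom k up (b ∷ c ∷ rest) = (b + k ≤ c) × AltFrom k down (c ∷ rest)
AltFrom k down (b ∷ c ∷ rest) = (c + k ≤ b) × AltFrom k up (c ∷ rest)

-- (b_1,…,b_m) is k-alternating: (-1)^j (b_j - b_{j+1}) ≥ k, j = 1 an up-step.
KAlternating : ℕ → List ℕ → Set
KAlternating k = AltFrom k up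

IsKAltSubseq : ∀ {n} → Permutation′ n → ℕ → List (Fin n) → Set
IsKAltSubseq π k as = Linked Fin._<_ as × KAlternating k (map (word π) as)

record St (n : ℕ) : Set where
  constructor st
  field
    cur : Fin n
    dir : Dir
    acc : List (Fin n)

step : ∀ {n} → (Fin n → ℕ) → ℕ → St n → Fin n → St n
step s k (st i up A) j with s i <? s j | s j <? s i + k
... | yes _ | yes _ = st i up A
step s k (st i up A) j | _ | _ with s j <? s i
... | yes _ = st j up A
... | no _  = st j down (A ++ [ i ])             -- s(j) ≥ s(i)+k
step s k (st i down A) j with s j <? s i | s i <? s j + k
... | yes _ | yes _ = st i down A
... | _ | _ with s i <? s j
... | yes _ = st j down A
... | no _  = st j up (A ++ [ i ])               -- s(j) ≤ s(i)-k

greedy : ∀ {m} → (Fin (suc m) → ℕ) → ℕ → List (Fin (suc m))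
greedy {m} s k with foldl (step s k) (st Fin.zero up []) (map Fin.suc (allFin m))
... | st i _ A = A ++ [ i ]

-- Call a value v better than u for a step in direction up if v ≤ u, and for
-- a step in direction down if v ≥ u.  After the loop has scanned the
-- positions before b, with current candidate i, state d and accepted set A,
-- the list A ∷ʳ i is a k-alternating subsequence whose next step would go in
-- direction d, and it is optimal: every k-alternating subsequence ending
-- before b has at most |A| + 1 terms, and if it has exactly |A| + 1 terms
-- then s(i) is at least as good as its last value for a step in direction d.
-- Each iteration of the loop preserves this invariant: if s(j) cannot be
-- reached from s(i) by a k-jump, then no equally long optimal competitor can
-- reach it either, so subsequences ending at j gain no length; otherwise the
-- accepted set grows by one.  For b = n this is the maximality claim.
module Submission where

open import Defs
open import Data.Nat using (ℕ; suc; _≤_)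
open import Data.Fin.Permutation using (Permutation′)
open import Data.List using (List; length)
open import Data.Fin using (Fin)
open import Data.Product using (_×_)

open import Data.Nat using (zero; _+_; _<_; _<?_; z≤n; s≤s)
open import Data.Nat.Properties
open import Data.Fin as F using (toℕ)
open import Data.Fin.Properties as Finₚ using (toℕ-injective; toℕ<n)
open import Data.List using ([]; _∷_; _∷ʳ_; map; foldl; allFin; tabulate)
open import Data.List.Properties using (length-++; map-tabulate)
open import Data.List.Relation.Unary.Linked using (Linked; []; [-]; _∷_)
open import Data.List.Reverse using ([]; _∶_∶ʳ_; reverseView)
open import Data.Product using (_,_; proj₁)
open import Data.Sum using (inj₁; inj₂)
open import Data.Unit using (tt)
open import Data.Empty using (⊥-elim)
open import Function using (_∘_; id; Injective; Injection)
open import Function.Properties.Inverse using (↔⇒↣)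
open import Relation.Nullary using (yes; no; ¬_)
open import Relation.Binary.PropositionalEquality
  using (_≡_; _≢_; refl; sym; trans; subst; subst₂)

length-∷ʳ : ∀ {A : Set} (xs : List A) x → length (xs ∷ʳ x) ≡ suc (length xs)
length-∷ʳ xs x = trans (length-++ xs) (+-comm (length xs) 1)

module _ {A : Set} {R : A → A → Set} where

  Linked-∷ʳ⁻ : ∀ xs {y x} → Linked R (xs ∷ʳ y ∷ʳ x) → Linked R (xs ∷ʳ y) × R y x
  Linked-∷ʳ⁻ []            (r ∷ _)  = [-] , r
  Linked-∷ʳ⁻ (_ ∷ [])      (r ∷ rs) = let rs′ , r′ = Linked-∷ʳ⁻ [] rs in r ∷ rs′ , r′
  Linked-∷ʳ⁻ (_ ∷ c ∷ cs)  (r ∷ rs) = let rs′ , r′ = Linked-∷ʳ⁻ (c ∷ cs) rs in r ∷ rs′ , r′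

  Linked-∷ʳ⁺ : ∀ xs {y x} → Linked R (xs ∷ʳ y) → R y x → Linked R (xs ∷ʳ y ∷ʳ x)
  Linked-∷ʳ⁺ []           _        r′ = r′ ∷ [-]
  Linked-∷ʳ⁺ (_ ∷ [])     (r ∷ rs) r′ = r ∷ Linked-∷ʳ⁺ [] rs r′
  Linked-∷ʳ⁺ (_ ∷ c ∷ cs) (r ∷ rs) r′ = r ∷ Linked-∷ʳ⁺ (c ∷ cs) rs r′

  Linked-replaceLast : ∀ xs {y x} → Linked R (xs ∷ʳ y) → (∀ {z} → R z y → R z x) →
                       Linked R (xs ∷ʳ x)
  Linked-replaceLast []           _        _ = [-]
  Linked-replaceLast (_ ∷ [])     (r ∷ _)  f = f r ∷ [-]
  Linked-replaceLast (_ ∷ c ∷ cs) (r ∷ rs) f = r ∷ Linked-replaceLast (c ∷ cs) rs f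

flip : Dir → Dir
flip up   = down
flip down = up

dirAfter : Dir → ℕ → Dir
dirAfter d zero    = d
dirAfter d (suc n) = dirAfter (flip d) n

dirAfter-∷ʳ : ∀ {A : Set} d (xs : List A) x →
              dirAfter d (length (xs ∷ʳ x)) ≡ flip (dirAfter d (length xs))
dirAfter-∷ʳ d []       x = refl
dirAfter-∷ʳ d (_ ∷ xs) x = dirAfter-∷ʳ (flip d) xs x

-- The order ≤ read in direction d: a ≤[ d ] b says that a is at least as
-- good as b as the start of a step in direction d.
infix 4 _≤[_]_
_≤[_]_ : ℕ → Dir → ℕ → Set
a ≤[ up ]   b = a ≤ b
a ≤[ down ] b = b ≤ a

≤[]-refl : ∀ {d a} → a ≤[ d ] a
≤[]-refl {up}   = ≤-refl
≤[]-refl {down} = ≤-refl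

≤[]-trans : ∀ {d a b c} → a ≤[ d ] b → b ≤[ d ] c → a ≤[ d ] c
≤[]-trans {up}   p q = ≤-trans p q
≤[]-trans {down} p q = ≤-trans q p

flip-≤[] : ∀ {d a b} → a ≤[ flip d ] b → b ≤[ d ] a
flip-≤[] {up}   p = p
flip-≤[] {down} p = p

Jump : ℕ → Dir → ℕ → ℕ → Set
Jump k up   a b = a + k ≤ b
Jump k down a b = b + k ≤ a

≤[]-Jump-trans : ∀ {k d a b c} → a ≤[ d ] b → Jump k d b c → Jump k d a c
≤[]-Jump-trans {k} {up}   p q = ≤-trans (+-monoˡ-≤ k p) q
≤[]-Jump-trans {k} {down} p q = ≤-trans q p

Jump-≤[]-trans : ∀ {k d a b c} → Jump k d a b → b ≤[ d ] c → Jump k d a c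
Jump-≤[]-trans {k} {up}   p q = ≤-trans p q
Jump-≤[]-trans {k} {down} p q = ≤-trans (+-monoˡ-≤ k q) p

module _ {k : ℕ} where

  AltFrom-uncons : ∀ d {a b r} → AltFrom k d (a ∷ b ∷ r) →
                   Jump k d a b × AltFrom k (flip d) (b ∷ r)
  AltFrom-uncons up   p = p
  AltFrom-uncons down p = p

  AltFrom-cons : ∀ d {a b r} → Jump k d a b → AltFrom k (flip d) (b ∷ r) →
                 AltFrom k d (a ∷ b ∷ r)
  AltFrom-cons up   p q = p , q
  AltFrom-cons down p q = p , q

  module _ {A : Set} (f : A → ℕ) where

    AltFrom-∷ʳ⁻ : ∀ d xs {y x} → AltFrom k d (map f (xs ∷ʳ y ∷ʳ x)) →
                  AltFrom k d (map f (xs ∷ʳ y)) × Jump k (dirAfter d (length xs)) (f y) (f x)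
    AltFrom-∷ʳ⁻ d []           p = tt , proj₁ (AltFrom-uncons d p)
    AltFrom-∷ʳ⁻ d (_ ∷ [])     p =
      let jump , rest = AltFrom-uncons d p
          rest′ , last = AltFrom-∷ʳ⁻ (flip d) [] rest
      in AltFrom-cons d jump rest′ , last
    AltFrom-∷ʳ⁻ d (_ ∷ c ∷ cs) p =
      let jump , rest = AltFrom-uncons d p
          rest′ , last = AltFrom-∷ʳ⁻ (flip d) (c ∷ cs) rest
      in AltFrom-cons d jump rest′ , last

    AltFrom-∷ʳ⁺ : ∀ d xs {y x} → AltFrom k d (map f (xs ∷ʳ y)) →
                  Jump k (dirAfter d (length xs)) (f y) (f x) → AltFrom k d (map f (xs ∷ʳ y ∷ʳ x))
    AltFrom-∷ʳ⁺ d []           _ last = AltFrom-cons d last tt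
    AltFrom-∷ʳ⁺ d (_ ∷ [])     p last =
      let jump , rest = AltFrom-uncons d p
      in AltFrom-cons d jump (AltFrom-∷ʳ⁺ (flip d) [] rest last)
    AltFrom-∷ʳ⁺ d (_ ∷ c ∷ cs) p last =
      let jump , rest = AltFrom-uncons d p
      in AltFrom-cons d jump (AltFrom-∷ʳ⁺ (flip d) (c ∷ cs) rest last)

    AltFrom-replaceLast : ∀ d xs {y x} → AltFrom k d (map f (xs ∷ʳ y)) →
                          f x ≤[ dirAfter d (length xs) ] f y → AltFrom k d (map f (xs ∷ʳ x))
    AltFrom-replaceLast d []           _ _   = tt
    AltFrom-replaceLast d (_ ∷ [])     p x≤y =
      let jump , _ = AltFrom-uncons d p
      in AltFrom-cons d (Jump-≤[]-trans jump (flip-≤[] x≤y)) tt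
    AltFrom-replaceLast d (_ ∷ c ∷ cs) p x≤y =
      let jump , rest = AltFrom-uncons d p
      in AltFrom-cons d jump (AltFrom-replaceLast (flip d) (c ∷ cs) rest x≤y)

module Greedy {M : ℕ} (w : Fin (suc M) → ℕ) (w-injective : Injective _≡_ _≡_ w) (k : ℕ) where

  Chain : List (Fin (suc M)) → Set
  Chain as = Linked F._<_ as × KAlternating k (map w as)

  chain-∷ʳ⁻ : ∀ as {y x} → Chain (as ∷ʳ y ∷ʳ x) →
              Chain (as ∷ʳ y) × y F.< x × Jump k (dirAfter up (length as)) (w y) (w x)
  chain-∷ʳ⁻ as (linked , alt) with Linked-∷ʳ⁻ as linked | AltFrom-∷ʳ⁻ w up as alt
  ... | linked′ , y<x | alt′ , jump = (linked′ , alt′) , y<x , jump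

  chain-∷ʳ⁺ : ∀ as {y x} → Chain (as ∷ʳ y) → y F.< x →
              Jump k (dirAfter up (length as)) (w y) (w x) → Chain (as ∷ʳ y ∷ʳ x)
  chain-∷ʳ⁺ as (linked , alt) y<x jump =
    Linked-∷ʳ⁺ as linked y<x , AltFrom-∷ʳ⁺ w up as alt jump

  chain-replaceLast : ∀ as {y x} → Chain (as ∷ʳ y) → y F.< x →
                      w x ≤[ dirAfter up (length as) ] w y → Chain (as ∷ʳ x)
  chain-replaceLast as (linked , alt) y<x x≤y =
    Linked-replaceLast as linked (λ z<y → <-trans z<y y<x) , AltFrom-replaceLast w up as alt x≤y

  Sound : ℕ → St (suc M) → Set
  Sound b (st i d A) = Chain (A ∷ʳ i) × toℕ i < b × d ≡ dirAfter up (length A)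

  Optimal : ℕ → St (suc M) → Set
  Optimal b (st i d A) = ∀ bs x → Chain (bs ∷ʳ x) → toℕ x < b →
    length bs ≤ length A × (length bs ≡ length A → w i ≤[ d ] w x)

  Invariant : ℕ → St (suc M) → Set
  Invariant b σ = Sound b σ × Optimal b σ

  data StepCase (i : Fin (suc M)) (d : Dir) (A : List (Fin (suc M))) (j : Fin (suc M)) :
                St (suc M) → Set where
    keep    : ¬ Jump k d (w i) (w j) → w i ≤[ d ] w j → StepCase i d A j (st i d A)
    replace : ¬ Jump k d (w i) (w j) → w j ≤[ d ] w i → StepCase i d A j (st j d A)
    accept  : Jump k d (w i) (w j) → StepCase i d A j (st j (flip d) (A ∷ʳ i))

  stepCase : ∀ i d A j → i ≢ j → StepCase i d A j (step w k (st i d A) j)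
  stepCase i up A j i≢j with w i <? w j | w j <? w i + k
  ... | yes i<j | yes j<i+k = keep (<⇒≱ j<i+k) (<⇒≤ i<j)
  ... | yes _   | no j≮i+k with w j <? w i
  ...   | yes j<i = replace (<⇒≱ (<-≤-trans j<i (m≤m+n (w i) k))) (<⇒≤ j<i)
  ...   | no _    = accept (≮⇒≥ j≮i+k)
  stepCase i up A j i≢j | no i≮j | _ with w j <? w i
  ...   | yes j<i = replace (<⇒≱ (<-≤-trans j<i (m≤m+n (w i) k))) (<⇒≤ j<i)
  ...   | no j≮i  = ⊥-elim (i≢j (w-injective (≤-antisym (≮⇒≥ j≮i) (≮⇒≥ i≮j))))
  stepCase i down A j i≢j with w j <? w i | w i <? w j + k
  ... | yes j<i | yes i<j+k = keep (<⇒≱ i<j+k) (<⇒≤ j<i)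
  ... | yes _   | no i≮j+k with w i <? w j
  ...   | yes i<j = replace (<⇒≱ (<-≤-trans i<j (m≤m+n (w j) k))) (<⇒≤ i<j)
  ...   | no _    = accept (≮⇒≥ i≮j+k)
  stepCase i down A j i≢j | no j≮i | _ with w i <? w j
  ...   | yes i<j = replace (<⇒≱ (<-≤-trans i<j (m≤m+n (w j) k))) (<⇒≤ i<j)
  ...   | no i≮j  = ⊥-elim (i≢j (w-injective (≤-antisym (≮⇒≥ j≮i) (≮⇒≥ i≮j))))

  optimal-keep : ∀ {i i′ d} A j → d ≡ dirAfter up (length A) → Optimal (toℕ j) (st i d A) →
                 ¬ Jump k d (w i) (w j) → (∀ {v} → w i ≤[ d ] v → w i′ ≤[ d ] v) →
                 w i′ ≤[ d ] w j → Optimal (suc (toℕ j)) (st i′ d A)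
  optimal-keep A j refl opt ¬jump better i′≤j bs x chain x≤j with m<1+n⇒m<n∨m≡n x≤j
  ... | inj₁ x<j with opt bs x chain x<j
  ...   | bs≤A , tie = bs≤A , better ∘ tie
  optimal-keep A j refl opt ¬jump better i′≤j bs x chain x≤j | inj₂ x≡j
    with toℕ-injective x≡j | reverseView bs
  ... | refl | [] = z≤n , λ _ → i′≤j
  ... | refl | cs ∶ _ ∶ʳ y with chain-∷ʳ⁻ cs chain
  ...   | chain′ , y<j , jump with opt cs y chain′ y<j
  ...     | cs≤A , tie = subst (_≤ length A) (sym (length-∷ʳ cs y)) (≤∧≢⇒< cs≤A cs≢A) , λ _ → i′≤j
    where
    -- an equally long competitor ending at y would let i jump to j as well
    cs≢A : length cs ≢ length A
    cs≢A eq = ¬jump (≤[]-Jump-trans (tie eq)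
                       (subst (λ n → Jump k (dirAfter up n) (w y) (w j)) eq jump))

  optimal-accept : ∀ {i d d′} A j → Optimal (toℕ j) (st i d A) →
                   Optimal (suc (toℕ j)) (st j d′ (A ∷ʳ i))
  optimal-accept {i} A j opt bs x chain x≤j
    rewrite length-∷ʳ A i with m<1+n⇒m<n∨m≡n x≤j
  ... | inj₁ x<j with opt bs x chain x<j
  ...   | bs≤A , _ = m≤n⇒m≤1+n bs≤A , λ bs≡1+A → ⊥-elim (1+n≰n (subst (_≤ length A) bs≡1+A bs≤A))
  optimal-accept {i} A j opt bs x chain x≤j | inj₂ x≡j
    with toℕ-injective x≡j | reverseView bs
  ... | refl | [] = z≤n , λ _ → ≤[]-refl
  ... | refl | cs ∶ _ ∶ʳ y with chain-∷ʳ⁻ cs chain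
  ...   | chain′ , y<j , _ with opt cs y chain′ y<j
  ...     | cs≤A , _ = subst (_≤ suc (length A)) (sym (length-∷ʳ cs y)) (s≤s cs≤A) , λ _ → ≤[]-refl

  step-preserves : ∀ {b σ} j → toℕ j ≡ b → Invariant b σ → Invariant (suc b) (step w k σ j)
  step-preserves {σ = st i d A} j refl ((chain , i<j , refl) , opt)
    with step w k (st i d A) j | stepCase i d A j (Finₚ.<⇒≢ i<j)
  ... | _ | keep ¬jump i≤j =
    (chain , m<n⇒m<1+n i<j , refl) , optimal-keep A j refl opt ¬jump id i≤j
  ... | _ | replace ¬jump j≤i =
    (chain-replaceLast A chain i<j j≤i , ≤-refl , refl) ,
    optimal-keep A j refl opt ¬jump (≤[]-trans j≤i) ≤[]-refl
  ... | _ | accept jump =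
    (chain-∷ʳ⁺ A chain i<j jump , ≤-refl , sym (dirAfter-∷ʳ up A i)) , optimal-accept A j opt

  Invariant-foldl : ∀ {c} b (js : Fin c → Fin (suc M)) → (∀ p → toℕ (js p) ≡ b + toℕ p) →
                    ∀ {σ} → Invariant b σ → Invariant (b + c) (foldl (step w k) σ (tabulate js))
  Invariant-foldl {zero} b js js≡ {σ} inv = subst (λ n → Invariant n σ) (sym (+-identityʳ b)) inv
  Invariant-foldl {suc c} b js js≡ {σ} inv =
    subst (λ n → Invariant n (foldl (step w k) σ (tabulate js))) (sym (+-suc b c))
      (Invariant-foldl (suc b) (js ∘ F.suc) (λ p → trans (js≡ (F.suc p)) (+-suc b (toℕ p)))
        (step-preserves (js F.zero) (trans (js≡ F.zero) (+-identityʳ b)) inv))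

  initial : Invariant 1 (st F.zero up [])
  initial = (([-] , tt) , s≤s z≤n , refl) , optimal
    where
    optimal : Optimal 1 (st F.zero up [])
    optimal bs F.zero    chain _ with reverseView bs
    ... | []          = z≤n , λ _ → ≤-refl
    ... | cs ∶ _ ∶ʳ _ with chain-∷ʳ⁻ cs chain
    ...   | _ , () , _
    optimal bs (F.suc _) _     (s≤s ())

  loop-invariant : Invariant (suc M) (foldl (step w k) (st F.zero up []) (map F.suc (allFin M)))
  loop-invariant = subst (λ js → Invariant (suc M) (foldl (step w k) (st F.zero up []) js))
                (sym (map-tabulate id F.suc))
                (Invariant-foldl 1 F.suc (λ _ → refl) initial)

  greedy-longest : Chain (greedy w k) × (∀ as → Chain as → length as ≤ length (greedy w k))
  greedy-longest with foldl (step w k) (st F.zero up []) (map F.suc (allFin M)) | loop-invariant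
  ... | st i d A | (chain , _) , optimal = chain , longest
    where
    longest : ∀ as → Chain as → length as ≤ length (A ∷ʳ i)
    longest as chain′ with reverseView as
    ... | []           = z≤n
    ... | bs ∶ _ ∶ʳ x with optimal bs x chain′ (toℕ<n x)
    ...   | bs≤A , _ = subst₂ _≤_ (sym (length-∷ʳ bs x)) (sym (length-∷ʳ A i)) (s≤s bs≤A)

word-injective : ∀ {n} (π : Permutation′ n) → Injective _≡_ _≡_ (word π)
word-injective π = Injection.injective (↔⇒↣ π) ∘ toℕ-injective ∘ suc-injective

lemma6 : (m k : ℕ) → 1 ≤ k → (π : Permutation′ (suc m)) →
    IsKAltSubseq π k (greedy (word π) k)
      × ((as : List (Fin (suc m))) → IsKAltSubseq π k as → length as ≤ length (greedy (word π) k))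
lemma6 m k _ π = Greedy.greedy-longest (word π) (word-injective π) k
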